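{- Let $n\ge3$, let $a,b\in C_n$ with $a\ne\bar b$, and let $u,v\in\{a,b\}^*$. Then $u\ \ddot{\sim}\ v$ if and only if $u=v$.
   Context: Let $n\ge2$ and $C_n=\{1<2<\cdots<n<\bar n<\overline{n-1}<\cdots<\bar 1\}$; for $x\in\{1,\dots,n\}$ set $\bar{\bar x}=x$. $C_n^*$ is the free monoid of words over $C_n$ and $|w|_a$ the number of occurrences of the letter $a$ in $w$. Convention: the symbols $n+1$ and $\overline{n+1}$ never occur in any word. For $i\in\{1,\dots,n\}$, $w$ has an $i$-inversion if $w=w_1xw_2yw_3$ with $x\in\{i,\overline{i+1}\}$, $y\in\{i+1,\bar i\}$. Quasi-crystal structure on $C_n^*$: $\mathrm{wt}(w)=(|w|_1-|w|_{\bar1},\dots,|w|_n-|w|_{\bar n})\in\mathbb{Z}^n$. For $i\in\{1,\dots,n\}$: if $w$ has an $i$-inversion then $\ddot{\varepsilon}_i(w)=\ddot{\varphi}_i(w)=+\infty$ and $\ddot{e}_i(w),\ddot{f}_i(w)$ are undefined; otherwise $\ddot{\varepsilon}_i(w)=|w|_{i+1}+|w|_{\bar i}$, $\ddot{\varphi}_i(w)=|w|_i+|w|_{\overline{i+1}}$; $\ddot{e}_i(w)$ is defined iff $\ddot{\varepsilon}_i(w)>0$ and is obtained by replacing the right-most letter of $w$ lying in $\{i+1,\bar i\}$ by its image ($i+1\mapsto i$, $\bar i\mapsto\overline{i+1}$ for $i<n$; $\bar n\mapsto n$ for $i=n$); $\ddot{f}_i(w)$ is defined iff $\ddot{\varphi}_i(w)>0$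 and is obtained by replacing the left-most letter of $w$ lying in $\{i,\overline{i+1}\}$ by its image ($i\mapsto i+1$, $\overline{i+1}\mapsto\bar i$ for $i<n$; $n\mapsto\bar n$ for $i=n$). The connected component $C_n^*(w)$ is the set of words obtained from $w$ by finitely many (defined) applications of the operators $\ddot{e}_i,\ddot{f}_i$. Hypoplactic congruence: $u\ddot{\sim}v$ iff there is a bijection $\psi:C_n^*(u)\to C_n^*(v)$ with $\psi(u)=v$ such that for all $x\in C_n^*(u)$ and $i$: $\psi(x)$ has the same $\mathrm{wt},\ddot{\varepsilon}_i,\ddot{\varphi}_i$ as $x$, $\ddot{e}_i(\psi(x))$ is defined iff $\ddot{e}_i(x)$ is (and then $\psi(\ddot{e}_i(x))=\ddot{e}_i(\psi(x))$), and likewise for $\ddot{f}_i$. -}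

module Defs where

open import Data.Nat using (ℕ; zero; suc; _<?_; _≡ᵇ_)
open import Data.Fin using (Fin; toℕ; fromℕ<)
open import Data.Bool using (Bool; true; false; if_then_else_; _∧_; _∨_)
open import Data.List using (List; []; _∷_; reverse)
open import Data.Bool.ListAction using (any)
open import Data.Maybe using (Maybe; just; nothing)
import Data.Maybe as Maybe
open import Data.Vec using (Vec; tabulate)
open import Data.Integer using (ℤ; _⊖_)
open import Data.Product using (Σ; _×_)
open import Relation.Nullary using (yes; no)
open import Relation.Binary.PropositionalEquality using (_≡_)

-- The alphabet C_n.  un j is the letter (toℕ j + 1), br j is its barred version.
-- Paper indices 1..n correspond to Fin n values 0..n-1.
data Letter (n : ℕ) : Set where
  un : Fin n → Letter n
  br : Fin n → Letter n

bar : ∀ {n} → Letter n → Letter n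
bar (un j) = br j
bar (br j) = un j

Word : ℕ → Set
Word n = List (Letter n)

countᵇ : ∀ {n} → (Letter n → Bool) → Word n → ℕ
countᵇ p [] = zero
countᵇ p (x ∷ w) = if p x then suc (countᵇ p w) else countᵇ p w

isUn isBr : ∀ {n} → Fin n → Letter n → Bool
isUn i (un j) = toℕ j ≡ᵇ toℕ i
isUn i (br j) = false
isBr i (un j) = false
isBr i (br j) = toℕ j ≡ᵇ toℕ i

wt : ∀ {n} → Word n → Vec ℤ n
wt w = tabulate (λ i → countᵇ (isUn i) w ⊖ countᵇ (isBr i) w)

-- x ∈ {i, bar(i+1)}   (letters n+1, bar(n+1) do not exist, automatically)
low : ∀ {n} → Fin n → Letter n → Bool
low i (un j) = toℕ j ≡ᵇ toℕ i
low i (br j) = toℕ j ≡ᵇ suc (toℕ i)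

high : ∀ {n} → Fin n → Letter n → Bool
high i (un j) = toℕ j ≡ᵇ suc (toℕ i)
high i (br j) = toℕ j ≡ᵇ toℕ i

hasInv : ∀ {n} → Fin n → Word n → Bool
hasInv i [] = false
hasInv i (x ∷ w) = (low i x ∧ any (high i) w) ∨ hasInv i w

-- image under f_i of a low letter: i ↦ i+1 (i<n), n ↦ bar n, bar(i+1) ↦ bar i
fImg : ∀ {n} → Fin n → Letter n → Letter n
fImg {n} i (un j) with suc (toℕ i) <? n
... | yes p = un (fromℕ< p)
... | no _ = br j
fImg i (br j) = br i

-- image under e_i of a high letter: i+1 ↦ i, bar i ↦ bar(i+1) (i<n), bar n ↦ n
eImg : ∀ {n} → Fin n → Letter n → Letter n
eImg i (un j) = un i
eImg {n} i (br j) with suc (toℕ i) <? n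
... | yes p = br (fromℕ< p)
... | no _ = un j

replaceFirst : ∀ {n} → (Letter n → Bool) → (Letter n → Letter n) → Word n → Maybe (Word n)
replaceFirst p g [] = nothing
replaceFirst p g (x ∷ w) = if p x then just (g x ∷ w) else Maybe.map (x ∷_) (replaceFirst p g w)

replaceLast : ∀ {n} → (Letter n → Bool) → (Letter n → Letter n) → Word n → Maybe (Word n)
replaceLast p g w = Maybe.map reverse (replaceFirst p g (reverse w))

data ℕ∞ : Set where
  fin : ℕ → ℕ∞
  ∞ : ℕ∞

εq : ∀ {n} → Fin n → Word n → ℕ∞
εq i w = if hasInv i w then ∞ else fin (countᵇ (high i) w)

φq : ∀ {n} → Fin n → Word n → ℕ∞
φq i w = if hasInv i w then ∞ else fin (countᵇ (low i) w)

eq : ∀ {n} → Fin n → Word n → Maybe (Word n)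
eq i w = if hasInv i w then nothing else replaceLast (high i) (eImg i) w

fq : ∀ {n} → Fin n → Word n → Maybe (Word n)
fq i w = if hasInv i w then nothing else replaceFirst (low i) (fImg i) w

data Reach {n : ℕ} (u : Word n) : Word n → Set where
  here  : Reach u u
  stepE : ∀ {x y} (i : Fin n) → Reach u x → eq i x ≡ just y → Reach u y
  stepF : ∀ {x y} (i : Fin n) → Reach u x → fq i x ≡ just y → Reach u y

record IsoComp {n : ℕ} (u v : Word n) (ψ : Word n → Word n) : Set where
  field
    base   : ψ u ≡ v
    into   : ∀ {x} → Reach u x → Reach v (ψ x)
    inj    : ∀ {x y} → Reach u x → Reach u y → ψ x ≡ ψ y → x ≡ y
    surj   : ∀ {y} → Reach v y → Σ (Word n) (λ x → Reach u x × ψ x ≡ y)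
    wt-eq  : ∀ {x} → Reach u x → wt (ψ x) ≡ wt x
    ε-eq   : ∀ {x} → Reach u x → (i : Fin n) → εq i (ψ x) ≡ εq i x
    φ-eq   : ∀ {x} → Reach u x → (i : Fin n) → φq i (ψ x) ≡ φq i x
    e-comm : ∀ {x} → Reach u x → (i : Fin n) → eq i (ψ x) ≡ Maybe.map ψ (eq i x)
    f-comm : ∀ {x} → Reach u x → (i : Fin n) → fq i (ψ x) ≡ Maybe.map ψ (fq i x)

_∼h_ : ∀ {n} → Word n → Word n → Set
_∼h_ {n} u v = Σ (Word n → Word n) (IsoComp u v)

module Submission where

-- Write u and v as images of Boolean words under true ↦ a, false ↦ b.  If a and b
-- have the same index then a = b and the weight fixes the length.  Otherwise the
-- weight fixes the numbers of a's and b's, and two distinct such words are told apart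
-- as follows.  An isomorphism of components commutes with every sequence of operators
-- ë_i, f̈_i and preserves ε̈_i, which is +∞ exactly on words with an i-inversion; so it
-- suffices to find a sequence, defined on both words, after which exactly one of them
-- has an i-inversion.  The duality w ↦ reverse (bar w), which exchanges ë_i and f̈_i,
-- and operators f̈_i that fix a and move b reduce this to a = p, b = bar (p+1), where
-- the sequence is built around the first position at which the two words differ.

open import Defs
open import Data.Bool using (Bool; true; false; not; if_then_else_; _∧_; _∨_)
open import Data.Bool.ListAction using (any)
import Data.Bool.Properties as Bool
open import Data.Bool.Properties using (T-≡; not-injective; ∨-zeroʳ; ∨-assoc; ∧-zeroʳ)
open import Data.Bool.Solver using (module ∨-∧-Solver)
open import Data.Fin using (Fin; toℕ; fromℕ<)
open import Data.Fin.Properties using (toℕ-fromℕ<; toℕ<n; toℕ-injective)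
import Data.Fin.Properties as Fin
open import Data.List using (List; []; _∷_; _++_; _∷ʳ_; [_]; map; reverse; replicate; length)
open import Data.List.Properties
  using (map-++; map-replicate; map-∘; map-cong; map-id; map-injective; reverse-map; reverse-++;
         reverse-involutive; reverse-injective; unfold-reverse; ∷ʳ-++; ++-assoc; ++-identityʳ; ≡-dec)
open import Data.List.Relation.Unary.All using (All; []; _∷_)
open import Data.List.Relation.Unary.All.Properties using (++⁺; ∷ʳ⁺)
open import Data.Maybe using (Maybe; just; nothing; _>>=_)
import Data.Maybe as Maybe
import Data.Maybe.Properties as Maybe
open import Data.Integer using (_⊖_; ∣_∣)
open import Data.Integer.Properties using (∣m⊖n∣≡∣n⊖m∣)
open import Data.Vec using (lookup)
open import Data.Vec.Properties using (lookup∘tabulate)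
open import Data.Nat using (ℕ; zero; suc; pred; _+_; _∸_; _≤_; _<_; _≡ᵇ_; _<?_; s≤s; >-nonZero)
open import Data.Nat.Properties
  using (_≟_; ≡ᵇ⇒≡; 1+n≢n; m≢1+n+m; +-comm; +-identityʳ; +-suc; suc-injective; suc-pred; pred[n]≤n;
         ≤-trans; ≤-<-trans; ≤-pred; ≮⇒≥; <⇒≢; m<n⇒m<1+n; m≤m+n; n≤1+n; m+[n∸m]≡n)
open import Data.Product using (Σ; _×_; _,_; proj₁; proj₂)
open import Data.Sum using (_⊎_; inj₁; inj₂)
import Data.Sum as Sum
open import Data.Empty using (⊥-elim)
open import Function using (_∘_; id; Equivalence)
open import Function.Bundles using (_⇔_; mk⇔)
open import Relation.Binary.Construct.Closure.ReflexiveTransitive using (Star; ε; _◅_; _◅◅_)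
open import Relation.Binary using (tri<; tri≈; tri>)
open import Relation.Nullary using (¬_; yes; no)
open import Relation.Nullary.Decidable using (dec-true; dec-false)
open import Relation.Binary.PropositionalEquality hiding ([_])
open ∨-∧-Solver using (solve; _:=_; _:+_; _:*_; con)
open ≡-Reasoning

≡ᵇ-true : ∀ {m k} → m ≡ k → (m ≡ᵇ k) ≡ true
≡ᵇ-true {m} {k} = dec-true (m ≟ k)

≡ᵇ-false : ∀ {m k} → m ≢ k → (m ≡ᵇ k) ≡ false
≡ᵇ-false {m} {k} = dec-false (m ≟ k)

≡ᵇ-sound : ∀ {m k} → (m ≡ᵇ k) ≡ true → m ≡ k
≡ᵇ-sound {m} {k} h = ≡ᵇ⇒≡ m k (Equivalence.from T-≡ h)

n≢1+n : ∀ {m} → m ≢ suc m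
n≢1+n e = 1+n≢n (sym e)

n≢2+n : ∀ {m} → m ≢ suc (suc m)
n≢2+n {m} = m≢1+n+m m {1}

module _ {n : ℕ} where

  LowFree HighFree : Fin n → Word n → Set
  LowFree i = All (λ x → low i x ≡ false)
  HighFree i = All (λ x → high i x ≡ false)

  low⇒¬high : ∀ (i : Fin n) x → low i x ≡ true → high i x ≡ false
  low⇒¬high i (un j) h = ≡ᵇ-false {toℕ j} λ e → 1+n≢n (trans (sym e) (≡ᵇ-sound {toℕ j} h))
  low⇒¬high i (br j) h = ≡ᵇ-false {toℕ j} λ e → n≢1+n (trans (sym e) (≡ᵇ-sound {toℕ j} h))

  high⇒¬low : ∀ (i : Fin n) x → high i x ≡ true → low i x ≡ false
  high⇒¬low i (un j) h = ≡ᵇ-false {toℕ j} λ e → n≢1+n (trans (sym e) (≡ᵇ-sound {toℕ j} h))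
  high⇒¬low i (br j) h = ≡ᵇ-false {toℕ j} λ e → 1+n≢n (trans (sym e) (≡ᵇ-sound {toℕ j} h))

  fImg-¬low : ∀ (i : Fin n) x → low i x ≡ true → low i (fImg i x) ≡ false
  fImg-¬low i (un j) h with suc (toℕ i) <? n
  ... | yes p = ≡ᵇ-false {toℕ (fromℕ< p)} λ e → 1+n≢n (trans (sym (toℕ-fromℕ< p)) e)
  ... | no _ = ≡ᵇ-false {toℕ j} λ e → 1+n≢n (trans (sym e) (≡ᵇ-sound {toℕ j} h))
  fImg-¬low i (br j) h = ≡ᵇ-false {toℕ i} n≢1+n

  fImg-un-< : ∀ (i j : Fin n) (p : suc (toℕ i) < n) → fImg i (un j) ≡ un (fromℕ< p)
  fImg-un-< i j p with suc (toℕ i) <? n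
  ... | yes _ = refl
  ... | no ¬p = ⊥-elim (¬p p)

  fImg-un-last : ∀ (i j : Fin n) → ¬ suc (toℕ i) < n → fImg i (un j) ≡ br j
  fImg-un-last i j ¬p with suc (toℕ i) <? n
  ... | yes p = ⊥-elim (¬p p)
  ... | no _ = refl

  eImg-br-< : ∀ (i j : Fin n) (p : suc (toℕ i) < n) → eImg i (br j) ≡ br (fromℕ< p)
  eImg-br-< i j p with suc (toℕ i) <? n
  ... | yes _ = refl
  ... | no ¬p = ⊥-elim (¬p p)

  any-++ : ∀ (p : Letter n → Bool) u w → any p (u ++ w) ≡ any p u ∨ any p w
  any-++ p [] w = refl
  any-++ p (x ∷ u) w = trans (cong (p x ∨_) (any-++ p u w)) (sym (∨-assoc (p x) _ _))

  any-false : ∀ (p : Letter n → Bool) w → All (λ x → p x ≡ false) w → any p w ≡ false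
  any-false p [] [] = refl
  any-false p (x ∷ w) (px ∷ pw) rewrite px = any-false p w pw

  any-true : ∀ (p : Letter n → Bool) u y w → p y ≡ true → any p (u ++ y ∷ w) ≡ true
  any-true p [] y w py rewrite py = refl
  any-true p (x ∷ u) y w py rewrite any-true p u y w py = ∨-zeroʳ (p x)

  hasInv-free : ∀ (i : Fin n) h t → LowFree i h → HighFree i t → hasInv i (h ++ t) ≡ false
  hasInv-free i [] [] _ _ = refl
  hasInv-free i [] (x ∷ t) _ (_ ∷ ht)
    rewrite any-false (high i) t ht | hasInv-free i [] t [] ht | ∧-zeroʳ (low i x) = refl
  hasInv-free i (x ∷ h) t (lx ∷ lh) ht rewrite lx = hasInv-free i h t lh ht

  hasInv-witness : ∀ (i : Fin n) p x q y r → low i x ≡ true → high i y ≡ true →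
                   hasInv i (p ++ x ∷ q ++ y ∷ r) ≡ true
  hasInv-witness i [] x q y r lx hy rewrite lx | any-true (high i) q y r hy = refl
  hasInv-witness i (z ∷ p) x q y r lx hy rewrite hasInv-witness i p x q y r lx hy = ∨-zeroʳ _

  hasInv-∷ʳ : ∀ (i : Fin n) w y → hasInv i (w ∷ʳ y) ≡ hasInv i w ∨ (any (low i) w ∧ high i y)
  hasInv-∷ʳ i [] y = cong (_∨ false) (∧-zeroʳ (low i y))
  hasInv-∷ʳ i (x ∷ w) y rewrite any-++ (high i) w [ y ] | hasInv-∷ʳ i w y =
    solve 5 (λ a b c d e → (a :* (b :+ (e :+ con false))) :+ (c :+ (d :* e))
                         := ((a :* b) :+ c) :+ ((a :+ d) :* e))
          refl (low i x) (any (high i) w) (hasInv i w) (any (low i) w) (high i y)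

  replaceFirst-++ : ∀ (p : Letter n → Bool) g h t → All (λ x → p x ≡ false) h →
                    replaceFirst p g (h ++ t) ≡ Maybe.map (h ++_) (replaceFirst p g t)
  replaceFirst-++ p g [] t [] = sym (Maybe.map-id _)
  replaceFirst-++ p g (x ∷ h) t (px ∷ ph) rewrite px | replaceFirst-++ p g h t ph =
    sym (Maybe.map-∘ (replaceFirst p g t))

  replaceFirst-map : ∀ (f : Letter n → Letter n) {p q : Letter n → Bool} {g k : Letter n → Letter n} →
    (∀ x → p (f x) ≡ q x) → (∀ x → g (f x) ≡ f (k x)) →
    ∀ w → replaceFirst p g (map f w) ≡ Maybe.map (map f) (replaceFirst q k w)
  replaceFirst-map f pq gk [] = refl
  replaceFirst-map f {q = q} {k = k} pq gk (x ∷ w) rewrite pq x with q x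
  ... | true = cong (λ y → just (y ∷ map f w)) (gk x)
  ... | false = begin
    Maybe.map (f x ∷_) (replaceFirst _ _ (map f w))
      ≡⟨ cong (Maybe.map (f x ∷_)) (replaceFirst-map f pq gk w) ⟩
    Maybe.map (f x ∷_) (Maybe.map (map f) (replaceFirst q k w))
      ≡⟨ Maybe.map-∘ (replaceFirst q k w) ⟨
    Maybe.map (map f ∘ (x ∷_)) (replaceFirst q k w)
      ≡⟨ Maybe.map-∘ (replaceFirst q k w) ⟩
    Maybe.map (map f) (Maybe.map (x ∷_) (replaceFirst q k w)) ∎

data Op (n : ℕ) : Set where
  E F : Fin n → Op n

module _ {n : ℕ} where

  apply : Op n → Word n → Maybe (Word n)
  apply (E i) = eq i
  apply (F i) = fq i

  run : List (Op n) → Word n → Maybe (Word n)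
  run [] w = just w
  run (o ∷ P) w = apply o w >>= run P

  run-∷ : ∀ {o} P {w w′} → apply o w ≡ just w′ → run (o ∷ P) w ≡ run P w′
  run-∷ P h rewrite h = refl

  run-++ : ∀ P Q {w w′} → run P w ≡ just w′ → run (P ++ Q) w ≡ run Q w′
  run-++ [] Q refl = refl
  run-++ (o ∷ P) Q {w} h with apply o w
  ... | just y = run-++ P Q h

  fq-first-low : ∀ (i : Fin n) h x t → LowFree i h → low i x ≡ true → HighFree i (x ∷ t) →
                 fq i (h ++ x ∷ t) ≡ just (h ++ fImg i x ∷ t)
  fq-first-low i h x t lh lx ht
    rewrite hasInv-free i h (x ∷ t) lh ht | replaceFirst-++ (low i) (fImg i) h (x ∷ t) lh | lx = refl

  raise lower : Fin n → Letter n → Letter n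
  raise i x = if low i x then fImg i x else x
  lower i x = if high i x then eImg i x else x

  raise-low : ∀ (i : Fin n) x → low i x ≡ true → raise i x ≡ fImg i x
  raise-low i x h rewrite h = refl

  raise-¬low : ∀ (i : Fin n) x → low i x ≡ false → raise i x ≡ x
  raise-¬low i x h rewrite h = refl

  lower-high : ∀ (i : Fin n) x → high i x ≡ true → lower i x ≡ eImg i x
  lower-high i x h rewrite h = refl

  lower-¬high : ∀ (i : Fin n) x → high i x ≡ false → lower i x ≡ x
  lower-¬high i x h rewrite h = refl

  -- f̈_i acts on the leftmost low letter, which lies in q, and raised letters join h;
  -- no inversion ever appears because every high letter precedes every low one.
  f-power : ∀ (i : Fin n) h q r → LowFree i h → HighFree i q → HighFree i r →
            run (replicate (countᵇ (low i) q) (F i)) (h ++ q ++ r) ≡ just (h ++ map (raise i) q ++ r)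
  f-power i h [] r lh hq hr = refl
  f-power i h (x ∷ q) r lh (hx ∷ hq) hr with low i x in lx
  ... | true = begin
    run (F i ∷ P) (h ++ x ∷ q ++ r)
      ≡⟨ run-∷ {F i} P {h ++ x ∷ q ++ r} (fq-first-low i h x (q ++ r) lh lx (hx ∷ ++⁺ hq hr)) ⟩
    run P (h ++ fImg i x ∷ q ++ r)
      ≡⟨ cong (run P) (∷ʳ-++ h (fImg i x) (q ++ r)) ⟨
    run P ((h ∷ʳ fImg i x) ++ q ++ r)
      ≡⟨ f-power i (h ∷ʳ fImg i x) q r (++⁺ lh (fImg-¬low i x lx ∷ [])) hq hr ⟩
    just ((h ∷ʳ fImg i x) ++ map (raise i) q ++ r)
      ≡⟨ cong just (∷ʳ-++ h (fImg i x) _) ⟩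
    just (h ++ fImg i x ∷ map (raise i) q ++ r) ∎
    where P : List (Op n)
          P = replicate (countᵇ (low i) q) (F i)
  ... | false = begin
    run P (h ++ x ∷ q ++ r)            ≡⟨ cong (run P) (∷ʳ-++ h x (q ++ r)) ⟨
    run P ((h ∷ʳ x) ++ q ++ r)         ≡⟨ f-power i (h ∷ʳ x) q r (++⁺ lh (lx ∷ [])) hq hr ⟩
    just ((h ∷ʳ x) ++ map (raise i) q ++ r) ≡⟨ cong just (∷ʳ-++ h x _) ⟩
    just (h ++ x ∷ map (raise i) q ++ r) ∎
    where P : List (Op n)
          P = replicate (countᵇ (low i) q) (F i)

  record Separated (u v : Word n) : Set where
    constructor separated
    field
      program : List (Op n)
      colour  : Fin n
      u′ v′   : Word n
      run-u   : run program u ≡ just u′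
      run-v   : run program v ≡ just v′
      inversions-differ : hasInv colour u′ ≢ hasInv colour v′

  separated-sym : ∀ {u v} → Separated u v → Separated v u
  separated-sym (separated P i u′ v′ hu hv d) = separated P i v′ u′ hv hu (d ∘ sym)

  separated-preimage : ∀ P {u v u₁ v₁} → run P u ≡ just u₁ → run P v ≡ just v₁ →
                       Separated u₁ v₁ → Separated u v
  separated-preimage P hu hv (separated Q i u′ v′ hu′ hv′ d) =
    separated (P ++ Q) i u′ v′ (trans (run-++ P Q hu) hu′) (trans (run-++ P Q hv) hv′) d

  εq≡⇒hasInv≡ : ∀ (i : Fin n) w w′ → εq i w ≡ εq i w′ → hasInv i w ≡ hasInv i w′
  εq≡⇒hasInv≡ i w w′ h with hasInv i w | hasInv i w′ | h
  ... | true  | true  | _ = refl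
  ... | false | false | _ = refl

  module _ {u v : Word n} {ψ : Word n → Word n} (iso : IsoComp u v ψ) where
    open IsoComp iso

    apply-ψ : ∀ o {x} → Reach u x → apply o (ψ x) ≡ Maybe.map ψ (apply o x)
    apply-ψ (E i) r = e-comm r i
    apply-ψ (F i) r = f-comm r i

    apply-reach : ∀ o {x y} → Reach u x → apply o x ≡ just y → Reach u y
    apply-reach (E i) = stepE i
    apply-reach (F i) = stepF i

    run-ψ : ∀ P {x z} → Reach u x → run P x ≡ just z → Reach u z × run P (ψ x) ≡ just (ψ z)
    run-ψ [] r refl = r , refl
    run-ψ (o ∷ P) {x} r h with apply o x in ex
    ... | just y rewrite apply-ψ o r | ex = run-ψ P (apply-reach o r ex) h

  separated⇒≁ : ∀ {u v} → Separated u v → ¬ (u ∼h v)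
  separated⇒≁ (separated P i u′ v′ hu hv d) (ψ , iso) =
    d (trans (sym (εq≡⇒hasInv≡ i (ψ u′) u′ (ε-eq reach-u′ i))) (cong (hasInv i) ψu′≡v′))
    where
      open IsoComp iso
      reach-u′ : Reach _ u′
      reach-u′ = proj₁ (run-ψ iso P here hu)
      ψu′≡v′ : ψ u′ ≡ v′
      ψu′≡v′ = Maybe.just-injective
        (trans (sym (proj₂ (run-ψ iso P here hu))) (trans (cong (run P) base) hv))

  -- Duality

  dual : Word n → Word n
  dual w = reverse (map bar w)

  dualOp : Op n → Op n
  dualOp (E i) = F i
  dualOp (F i) = E i

  bar-involutive : ∀ (x : Letter n) → bar (bar x) ≡ x
  bar-involutive (un j) = refl
  bar-involutive (br j) = refl

  dual-involutive : ∀ w → dual (dual w) ≡ w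
  dual-involutive w = begin
    reverse (map bar (reverse (map bar w))) ≡⟨ cong reverse (reverse-map bar (map bar w)) ⟩
    reverse (reverse (map bar (map bar w))) ≡⟨ reverse-involutive _ ⟩
    map bar (map bar w)                     ≡⟨ map-∘ w ⟨
    map (bar ∘ bar) w                       ≡⟨ map-cong bar-involutive w ⟩
    map id w                                ≡⟨ map-id w ⟩
    w                                       ∎

  dual-reverse : ∀ w → dual (reverse w) ≡ map bar w
  dual-reverse w = trans (cong reverse (reverse-map bar w)) (reverse-involutive _)

  dual-∷ : ∀ x w → dual (x ∷ w) ≡ dual w ∷ʳ bar x
  dual-∷ x w = unfold-reverse (bar x) (map bar w)

  dual-++ : ∀ u w → dual (u ++ w) ≡ dual w ++ dual u
  dual-++ u w = trans (cong reverse (map-++ bar u w)) (reverse-++ (map bar u) (map bar w))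

  All-dual : ∀ {P Q : Letter n → Set} → (∀ {x} → P x → Q (bar x)) → ∀ {w} → All P w → All Q (dual w)
  All-dual f {[]} [] = []
  All-dual f {x ∷ w} (px ∷ pw) rewrite dual-∷ x w = ++⁺ (All-dual f pw) (f px ∷ [])

  low-bar : ∀ (i : Fin n) x → low i (bar x) ≡ high i x
  low-bar i (un j) = refl
  low-bar i (br j) = refl

  high-bar : ∀ (i : Fin n) x → high i (bar x) ≡ low i x
  high-bar i (un j) = refl
  high-bar i (br j) = refl

  fImg-bar : ∀ (i : Fin n) x → fImg i (bar x) ≡ bar (eImg i x)
  fImg-bar i (un j) = refl
  fImg-bar i (br j) with suc (toℕ i) <? n
  ... | yes _ = refl
  ... | no _ = refl

  raise-bar : ∀ (i : Fin n) x → raise i (bar x) ≡ bar (lower i x)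
  raise-bar i x rewrite low-bar i x with high i x
  ... | true = fImg-bar i x
  ... | false = refl

  any-dual : ∀ (i : Fin n) w → any (low i) (dual w) ≡ any (high i) w
  any-dual i [] = refl
  any-dual i (x ∷ w) rewrite dual-∷ x w | any-++ (low i) (dual w) [ bar x ] | any-dual i w | low-bar i x =
    solve 2 (λ a b → b :+ (a :+ con false) := a :+ b) refl (high i x) (any (high i) w)

  hasInv-dual : ∀ (i : Fin n) w → hasInv i (dual w) ≡ hasInv i w
  hasInv-dual i [] = refl
  hasInv-dual i (x ∷ w)
    rewrite dual-∷ x w | hasInv-∷ʳ i (dual w) (bar x) | hasInv-dual i w | any-dual i w | high-bar i x =
    solve 3 (λ a b c → c :+ (b :* a) := (a :* b) :+ c) refl (low i x) (any (high i) w) (hasInv i w)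

  countᵇ-++ : ∀ (p : Letter n → Bool) u w → countᵇ p (u ++ w) ≡ countᵇ p u + countᵇ p w
  countᵇ-++ p [] w = refl
  countᵇ-++ p (x ∷ u) w with p x
  ... | true = cong suc (countᵇ-++ p u w)
  ... | false = countᵇ-++ p u w

  countᵇ-dual : ∀ (i : Fin n) w → countᵇ (low i) (dual w) ≡ countᵇ (high i) w
  countᵇ-dual i [] = refl
  countᵇ-dual i (x ∷ w)
    rewrite dual-∷ x w | countᵇ-++ (low i) (dual w) [ bar x ] | countᵇ-dual i w | low-bar i x with high i x
  ... | true = +-comm _ 1
  ... | false = +-identityʳ _

  fq-dual : ∀ (i : Fin n) w → fq i (dual w) ≡ Maybe.map dual (eq i w)
  fq-dual i w rewrite hasInv-dual i w with hasInv i w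
  ... | true = refl
  ... | false = begin
    replaceFirst (low i) (fImg i) (reverse (map bar w))
      ≡⟨ cong (replaceFirst _ _) (reverse-map bar w) ⟨
    replaceFirst (low i) (fImg i) (map bar (reverse w))
      ≡⟨ replaceFirst-map bar (low-bar i) (fImg-bar i) (reverse w) ⟩
    Maybe.map (map bar) R                               ≡⟨ Maybe.map-cong dual-reverse R ⟨
    Maybe.map (dual ∘ reverse) R                        ≡⟨ Maybe.map-∘ R ⟩
    Maybe.map dual (Maybe.map reverse R)                ∎
    where R : Maybe (Word n)
          R = replaceFirst (high i) (eImg i) (reverse w)

  eq-dual : ∀ (i : Fin n) w → eq i (dual w) ≡ Maybe.map dual (fq i w)
  eq-dual i w = begin
    M                                  ≡⟨ Maybe.map-id M ⟨
    Maybe.map id M                     ≡⟨ Maybe.map-cong dual-involutive M ⟨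
    Maybe.map (dual ∘ dual) M          ≡⟨ Maybe.map-∘ M ⟩
    Maybe.map dual (Maybe.map dual M)  ≡⟨ cong (Maybe.map dual) (fq-dual i (dual w)) ⟨
    Maybe.map dual (fq i (dual (dual w))) ≡⟨ cong (Maybe.map dual ∘ fq i) (dual-involutive w) ⟩
    Maybe.map dual (fq i w)            ∎
    where M : Maybe (Word n)
          M = eq i (dual w)

  apply-dual : ∀ o w → apply (dualOp o) (dual w) ≡ Maybe.map dual (apply o w)
  apply-dual (E i) = fq-dual i
  apply-dual (F i) = eq-dual i

  run-dual : ∀ P w → run (map dualOp P) (dual w) ≡ Maybe.map dual (run P w)
  run-dual [] w = refl
  run-dual (o ∷ P) w rewrite apply-dual o w with apply o w
  ... | just y = run-dual P y
  ... | nothing = refl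

  separated-dual : ∀ {u v} → Separated (dual u) (dual v) → Separated u v
  separated-dual {u} {v} (separated P i u′ v′ hu hv d) =
    separated (map dualOp P) i (dual u′) (dual v′) (back u hu) (back v hv)
      λ e → d (trans (sym (hasInv-dual i u′)) (trans e (hasInv-dual i v′)))
    where
      back : ∀ w {w′} → run P (dual w) ≡ just w′ → run (map dualOp P) w ≡ just (dual w′)
      back w {w′} h = begin
        run (map dualOp P) w               ≡⟨ cong (run (map dualOp P)) (dual-involutive w) ⟨
        run (map dualOp P) (dual (dual w)) ≡⟨ run-dual P (dual w) ⟩
        Maybe.map dual (run P (dual w))    ≡⟨ cong (Maybe.map dual) h ⟩
        just (dual w′)                     ∎

  map-raise-dual : ∀ (i : Fin n) w → map (raise i) (dual w) ≡ dual (map (lower i) w)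
  map-raise-dual i w = begin
    map (raise i) (reverse (map bar w)) ≡⟨ reverse-map (raise i) (map bar w) ⟩
    reverse (map (raise i) (map bar w)) ≡⟨ cong reverse (map-∘ w) ⟨
    reverse (map (raise i ∘ bar) w)     ≡⟨ cong reverse (map-cong (raise-bar i) w) ⟩
    reverse (map (bar ∘ lower i) w)     ≡⟨ cong reverse (map-∘ w) ⟩
    dual (map (lower i) w)              ∎

  e-power : ∀ (i : Fin n) l q → LowFree i l → LowFree i q →
            run (replicate (countᵇ (high i) q) (E i)) (l ++ q) ≡ just (l ++ map (lower i) q)
  e-power i l q ll lq = begin
    run (replicate k (E i)) (l ++ q)
      ≡⟨ cong₂ run (map-replicate dualOp k (F i)) (dual-involutive (l ++ q)) ⟨
    run (map dualOp (replicate k (F i))) (dual (dual (l ++ q)))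
      ≡⟨ run-dual (replicate k (F i)) (dual (l ++ q)) ⟩
    Maybe.map dual (run (replicate k (F i)) (dual (l ++ q)))
      ≡⟨ cong₂ (λ m w → Maybe.map dual (run (replicate m (F i)) w)) (countᵇ-dual i q) (sym (dual-++ l q)) ⟨
    Maybe.map dual (run (replicate (countᵇ (low i) (dual q)) (F i)) (dual q ++ dual l))
      ≡⟨ cong (Maybe.map dual) (f-power i [] (dual q) (dual l) [] (high-free lq) (high-free ll)) ⟩
    just (dual (map (raise i) (dual q) ++ dual l))
      ≡⟨ cong (λ w → just (dual (w ++ dual l))) (map-raise-dual i q) ⟩
    just (dual (dual (map (lower i) q) ++ dual l))
      ≡⟨ cong just (dual-++ (dual (map (lower i) q)) (dual l)) ⟩
    just (dual (dual l) ++ dual (dual (map (lower i) q)))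
      ≡⟨ cong₂ (λ a b → just (a ++ b)) (dual-involutive l) (dual-involutive _) ⟩
    just (l ++ map (lower i) q) ∎
    where
      k : ℕ
      k = countᵇ (high i) q
      high-free : ∀ {w} → LowFree i w → HighFree i (dual w)
      high-free = All-dual λ {x} h → trans (high-bar i x) h

tally : Bool → Bool → List Bool → ℕ
tally t f [] = 0
tally t f (true ∷ s) = if t then suc (tally t f s) else tally t f s
tally t f (false ∷ s) = if f then suc (tally t f s) else tally t f s

trues falses : List Bool → ℕ
trues = tally true false
falses = tally false true

tally-++ : ∀ t f s s′ → tally t f (s ++ s′) ≡ tally t f s + tally t f s′
tally-++ t f [] s′ = refl
tally-++ true f (true ∷ s) s′ = cong suc (tally-++ true f s s′)
tally-++ false f (true ∷ s) s′ = tally-++ false f s s′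
tally-++ t true (false ∷ s) s′ = cong suc (tally-++ t true s s′)
tally-++ t false (false ∷ s) s′ = tally-++ t false s s′

tally-reverse : ∀ t f s → tally t f (reverse s) ≡ tally t f s
tally-reverse t f [] = refl
tally-reverse t f (b ∷ s)
  rewrite unfold-reverse b s | tally-++ t f (reverse s) [ b ] | tally-reverse t f s with b | t | f
... | true  | true  | _     = +-comm _ 1
... | true  | false | _     = +-identityʳ _
... | false | _     | true  = +-comm _ 1
... | false | _     | false = +-identityʳ _

tally-map-not : ∀ t f s → tally t f (map not s) ≡ tally f t s
tally-map-not t f [] = refl
tally-map-not t f (true ∷ s) rewrite tally-map-not t f s = refl
tally-map-not t f (false ∷ s) rewrite tally-map-not t f s = refl

tally-true-true : ∀ s → tally true true s ≡ length s
tally-true-true [] = refl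
tally-true-true (true ∷ s) = cong suc (tally-true-true s)
tally-true-true (false ∷ s) = cong suc (tally-true-true s)

tally-false-false : ∀ s → tally false false s ≡ 0
tally-false-false [] = refl
tally-false-false (true ∷ s) = tally-false-false s
tally-false-false (false ∷ s) = tally-false-false s

data FirstDifference : List Bool → List Bool → Set where
  diff : ∀ w r₁ r₂ → falses r₁ ≡ suc (falses r₂) → FirstDifference (w ++ true ∷ r₁) (w ++ false ∷ r₂)

diff-∷ : ∀ b {s₁ s₂} → FirstDifference s₁ s₂ → FirstDifference (b ∷ s₁) (b ∷ s₂)
diff-∷ b (diff w r₁ r₂ h) = diff (b ∷ w) r₁ r₂ h

first-difference : ∀ s₁ s₂ → s₁ ≢ s₂ → trues s₁ ≡ trues s₂ → falses s₁ ≡ falses s₂ →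
                   FirstDifference s₁ s₂ ⊎ FirstDifference s₂ s₁
first-difference [] [] s≢ _ _ = ⊥-elim (s≢ refl)
first-difference [] (true ∷ s₂) _ () _
first-difference [] (false ∷ s₂) _ _ ()
first-difference (true ∷ s₁) [] _ () _
first-difference (false ∷ s₁) [] _ _ ()
first-difference (true ∷ s₁) (false ∷ s₂) _ _ f≡ = inj₁ (diff [] s₁ s₂ f≡)
first-difference (false ∷ s₁) (true ∷ s₂) _ _ f≡ = inj₂ (diff [] s₂ s₁ (sym f≡))
first-difference (true ∷ s₁) (true ∷ s₂) s≢ t≡ f≡ =
  Sum.map (diff-∷ true) (diff-∷ true)
    (first-difference s₁ s₂ (s≢ ∘ cong (true ∷_)) (suc-injective t≡) f≡)
first-difference (false ∷ s₁) (false ∷ s₂) s≢ t≡ f≡ =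
  Sum.map (diff-∷ false) (diff-∷ false)
    (first-difference s₁ s₂ (s≢ ∘ cong (false ∷_)) t≡ (suc-injective f≡))

split-at-false : ∀ r {k} → falses r ≡ suc k →
                 Σ (List Bool) λ a → Σ (List Bool) λ b → r ≡ a ++ false ∷ b × falses b ≡ k
split-at-false [] ()
split-at-false (true ∷ r) h with split-at-false r h
... | a , b , refl , fb = true ∷ a , b , refl , fb
split-at-false (false ∷ r) h = [] , r , refl , suc-injective h

module _ {n : ℕ} where

  embed : Letter n → Letter n → List Bool → Word n
  embed x y = map (λ b → if b then x else y)

  embed-++ : ∀ x y s s′ → embed x y (s ++ s′) ≡ embed x y s ++ embed x y s′
  embed-++ x y = map-++ _

  countᵇ-embed : ∀ (p : Letter n → Bool) x y s → countᵇ p (embed x y s) ≡ tally (p x) (p y) s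
  countᵇ-embed p x y [] = refl
  countᵇ-embed p x y (true ∷ s) rewrite countᵇ-embed p x y s = refl
  countᵇ-embed p x y (false ∷ s) rewrite countᵇ-embed p x y s = refl

  map-embed : ∀ (f : Letter n → Letter n) x y s → map f (embed x y s) ≡ embed (f x) (f y) s
  map-embed f x y [] = refl
  map-embed f x y (true ∷ s) = cong (f x ∷_) (map-embed f x y s)
  map-embed f x y (false ∷ s) = cong (f y ∷_) (map-embed f x y s)

  embed-swap : ∀ x y s → embed x y s ≡ embed y x (map not s)
  embed-swap x y [] = refl
  embed-swap x y (true ∷ s) = cong (x ∷_) (embed-swap x y s)
  embed-swap x y (false ∷ s) = cong (y ∷_) (embed-swap x y s)

  dual-embed : ∀ x y s → dual (embed x y s) ≡ embed (bar x) (bar y) (reverse s)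
  dual-embed x y s = trans (cong reverse (map-embed bar x y s)) (sym (reverse-map _ s))

  All-embed : ∀ {P : Letter n → Set} {x y} → P x → P y → ∀ {s} → All P (embed x y s)
  All-embed px py {[]} = []
  All-embed px py {true ∷ s} = px ∷ All-embed px py
  All-embed px py {false ∷ s} = py ∷ All-embed px py

  embed-of : ∀ x y w → All (λ c → c ≡ x ⊎ c ≡ y) w → Σ (List Bool) λ s → w ≡ embed x y s
  embed-of x y [] [] = [] , refl
  embed-of x y (c ∷ w) (c∈ ∷ w∈) with embed-of x y w w∈
  embed-of x y (c ∷ w) (inj₁ refl ∷ _) | s , refl = true ∷ s , refl
  embed-of x y (c ∷ w) (inj₂ refl ∷ _) | s , refl = false ∷ s , refl

  Separating : Letter n → Letter n → Set
  Separating x y = ∀ s₁ s₂ → s₁ ≢ s₂ → trues s₁ ≡ trues s₂ → falses s₁ ≡ falses s₂ →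
                   Separated (embed x y s₁) (embed x y s₂)

  separating-swap : ∀ {x y} → Separating y x → Separating x y
  separating-swap {x} {y} sep s₁ s₂ s≢ t≡ f≡ =
    subst₂ Separated (sym (embed-swap x y s₁)) (sym (embed-swap x y s₂))
      (sep (map not s₁) (map not s₂) (s≢ ∘ map-injective not-injective)
           (trans (tally-map-not true false s₁) (trans f≡ (sym (tally-map-not true false s₂))))
           (trans (tally-map-not false true s₁) (trans t≡ (sym (tally-map-not false true s₂)))))

  separating-dual : ∀ {x y} → Separating (bar x) (bar y) → Separating x y
  separating-dual {x} {y} sep s₁ s₂ s≢ t≡ f≡ =
    separated-dual (subst₂ Separated (sym (dual-embed x y s₁)) (sym (dual-embed x y s₂))
      (sep (reverse s₁) (reverse s₂) (s≢ ∘ reverse-injective)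
           (trans (tally-reverse true false s₁) (trans t≡ (sym (tally-reverse true false s₂))))
           (trans (tally-reverse false true s₁) (trans f≡ (sym (tally-reverse false true s₂))))))

  data Step (x y y′ : Letter n) : Set where
    step : ∀ i → low i y ≡ true → low i x ≡ false → high i x ≡ false → fImg i y ≡ y′ → Step x y y′

  separating-step : ∀ {x y y′} → Step x y y′ → Separating x y′ → Separating x y
  separating-step {x} {y} {y′} (step i ly lx hx fy) sep s₁ s₂ s≢ t≡ f≡ =
    separated-preimage P (raised s₁ f≡) (raised s₂ refl) (sep s₁ s₂ s≢ t≡ f≡)
    where
      P : List (Op n)
      P = replicate (falses s₂) (F i)
      raised : ∀ s → falses s ≡ falses s₂ → run P (embed x y s) ≡ just (embed x y′ s)
      raised s e = begin
        run P (embed x y s)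
          ≡⟨ cong₂ (λ k w → run (replicate k (F i)) w)
                   (trans (countᵇ-embed (low i) x y s) (trans (cong₂ (λ a b → tally a b s) lx ly) e))
                   (++-identityʳ _) ⟨
        run (replicate (countᵇ (low i) (embed x y s)) (F i)) (embed x y s ++ [])
          ≡⟨ f-power i [] (embed x y s) [] [] (All-embed hx (low⇒¬high i y ly)) [] ⟩
        just (map (raise i) (embed x y s) ++ [])
          ≡⟨ cong just (trans (++-identityʳ _) (map-embed (raise i) x y s)) ⟩
        just (embed (raise i x) (raise i y) s)
          ≡⟨ cong₂ (λ a b → just (embed a b s)) (raise-¬low i x lx) (trans (raise-low i y ly) fy) ⟩
        just (embed x y′ s) ∎

  separating-along : ∀ {x y y′} → Star (Step x) y y′ → Separating x y′ → Separating x y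
  separating-along ε sep = sep
  separating-along (s ◅ path) sep = separating-step s (separating-along path sep)

  regroup : ∀ (p : Word n) x q y r → (p ++ x ∷ q ∷ʳ y) ++ r ≡ p ++ x ∷ q ++ y ∷ r
  regroup p x q y r = trans (++-assoc p (x ∷ q ∷ʳ y) r) (cong (λ z → p ++ x ∷ z) (∷ʳ-++ q y r))

  -- The separating gadget

  -- Let u and v first differ by X in u against Y in v, after a common prefix w, so that
  -- u has one Y more than v behind that position.  Applying ë_t once per Y behind the
  -- position in v lowers all those Y's of v and all but one of u; then f̈_g raises w
  -- and the differing letter.  In u the raised X is t-low and precedes the surviving
  -- t-high Y, whereas v is left without any t-high letter.
  record Gadget (X Y : Letter n) : Set where
    field
      g t        : Fin n
      X-low-g    : low g X ≡ true
      Y-low-g    : low g Y ≡ true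
      X-¬low-t   : low t X ≡ false
      X-¬high-t  : high t X ≡ false
      Y-high-t   : high t Y ≡ true
      eY-¬high-g : high g (eImg t Y) ≡ false
      eY-¬high-t : high t (eImg t Y) ≡ false
      fX-low-t   : low t (fImg g X) ≡ true
      fY-¬high-t : high t (fImg g Y) ≡ false

  module _ {X Y : Letter n} (G : Gadget X Y) where
    open Gadget G

    Y′ X⁺ Y⁺ : Letter n
    Y′ = eImg t Y
    X⁺ = fImg g X
    Y⁺ = fImg g Y

    g-highfree : ∀ {s} → HighFree g (embed X Y s)
    g-highfree = All-embed (low⇒¬high g X X-low-g) (low⇒¬high g Y Y-low-g)

    Y-¬low-t : low t Y ≡ false
    Y-¬low-t = high⇒¬low t Y Y-high-t

    t-lowfree : ∀ {s} → LowFree t (embed X Y s)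
    t-lowfree = All-embed X-¬low-t Y-¬low-t

    lower-suffix : ∀ l r → LowFree t l →
                   run (replicate (falses r) (E t)) (l ++ embed X Y r) ≡ just (l ++ embed X Y′ r)
    lower-suffix l r ll = begin
      run (replicate (falses r) (E t)) (l ++ embed X Y r)
        ≡⟨ cong (λ k → run (replicate k (E t)) (l ++ embed X Y r))
                (trans (countᵇ-embed (high t) X Y r) (cong₂ (λ a b → tally a b r) X-¬high-t Y-high-t)) ⟨
      run (replicate (countᵇ (high t) (embed X Y r)) (E t)) (l ++ embed X Y r)
        ≡⟨ e-power t l (embed X Y r) ll t-lowfree ⟩
      just (l ++ map (lower t) (embed X Y r))
        ≡⟨ cong (λ z → just (l ++ z)) (map-embed (lower t) X Y r) ⟩
      just (l ++ embed (lower t X) (lower t Y) r)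
        ≡⟨ cong₂ (λ a b → just (l ++ embed a b r)) (lower-¬high t X X-¬high-t) (lower-high t Y Y-high-t) ⟩
      just (l ++ embed X Y′ r) ∎

    lower-true-branch : ∀ w a b → run (replicate (falses b) (E t)) (embed X Y (w ++ true ∷ a ++ false ∷ b))
                        ≡ just (embed X Y w ++ X ∷ embed X Y a ++ Y ∷ embed X Y′ b)
    lower-true-branch w a b = begin
      run E* (embed X Y (w ++ true ∷ a ++ false ∷ b))
        ≡⟨ cong (run E*) (embed-++ X Y w _) ⟩
      run E* (embed X Y w ++ X ∷ embed X Y (a ++ false ∷ b))
        ≡⟨ cong (λ z → run E* (embed X Y w ++ X ∷ z)) (embed-++ X Y a _) ⟩
      run E* (embed X Y w ++ X ∷ embed X Y a ++ Y ∷ embed X Y b)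
        ≡⟨ cong (run E*) (regroup _ X _ Y _) ⟨
      run E* ((embed X Y w ++ X ∷ embed X Y a ∷ʳ Y) ++ embed X Y b)
        ≡⟨ lower-suffix _ b (++⁺ t-lowfree (X-¬low-t ∷ ∷ʳ⁺ t-lowfree Y-¬low-t)) ⟩
      just ((embed X Y w ++ X ∷ embed X Y a ∷ʳ Y) ++ embed X Y′ b)
        ≡⟨ cong just (regroup _ X _ Y _) ⟩
      just (embed X Y w ++ X ∷ embed X Y a ++ Y ∷ embed X Y′ b) ∎
      where E* : List (Op n)
            E* = replicate (falses b) (E t)

    lower-false-branch : ∀ w r → run (replicate (falses r) (E t)) (embed X Y (w ++ false ∷ r))
                         ≡ just (embed X Y w ++ Y ∷ embed X Y′ r)
    lower-false-branch w r = begin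
      run E* (embed X Y (w ++ false ∷ r))       ≡⟨ cong (run E*) (embed-++ X Y w _) ⟩
      run E* (embed X Y w ++ Y ∷ embed X Y r)   ≡⟨ cong (run E*) (∷ʳ-++ _ Y _) ⟨
      run E* ((embed X Y w ∷ʳ Y) ++ embed X Y r) ≡⟨ lower-suffix _ r (∷ʳ⁺ t-lowfree Y-¬low-t) ⟩
      just ((embed X Y w ∷ʳ Y) ++ embed X Y′ r) ≡⟨ cong just (∷ʳ-++ _ Y _) ⟩
      just (embed X Y w ++ Y ∷ embed X Y′ r)    ∎
      where E* : List (Op n)
            E* = replicate (falses r) (E t)

    raise-prefix : ∀ w z rest → low g z ≡ true → HighFree g rest →
                   run (replicate (length w + 1) (F g)) (embed X Y w ++ z ∷ rest)
                   ≡ just (embed X⁺ Y⁺ w ++ fImg g z ∷ rest)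
    raise-prefix w z rest lz hr = begin
      run (replicate (length w + 1) (F g)) (embed X Y w ++ z ∷ rest)
        ≡⟨ cong₂ (λ k → run (replicate k (F g))) count (∷ʳ-++ _ z rest) ⟨
      run (replicate (countᵇ (low g) (embed X Y w ∷ʳ z)) (F g)) ((embed X Y w ∷ʳ z) ++ rest)
        ≡⟨ f-power g [] _ rest [] (++⁺ g-highfree (low⇒¬high g z lz ∷ [])) hr ⟩
      just (map (raise g) (embed X Y w ∷ʳ z) ++ rest)
        ≡⟨ cong (λ q → just (q ++ rest)) (map-++ (raise g) (embed X Y w) [ z ]) ⟩
      just ((map (raise g) (embed X Y w) ∷ʳ raise g z) ++ rest)
        ≡⟨ cong just (∷ʳ-++ _ _ rest) ⟩
      just (map (raise g) (embed X Y w) ++ raise g z ∷ rest)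
        ≡⟨ cong₂ (λ p x → just (p ++ x ∷ rest)) raised (raise-low g z lz) ⟩
      just (embed X⁺ Y⁺ w ++ fImg g z ∷ rest) ∎
      where
        count : countᵇ (low g) (embed X Y w ∷ʳ z) ≡ length w + 1
        count rewrite countᵇ-++ (low g) (embed X Y w) [ z ] | countᵇ-embed (low g) X Y w
                    | X-low-g | Y-low-g | lz | tally-true-true w = refl
        raised : map (raise g) (embed X Y w) ≡ embed X⁺ Y⁺ w
        raised = trans (map-embed (raise g) X Y w)
                       (cong₂ (λ a b → embed a b w) (raise-low g X X-low-g) (raise-low g Y Y-low-g))

    separated-at : ∀ {s₁ s₂} → FirstDifference s₁ s₂ → Separated (embed X Y s₁) (embed X Y s₂)
    separated-at (diff w r₁ r₂ h) with split-at-false r₁ h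
    ... | a , b , refl , fb =
      separated (E* ++ F*) t u′ v′
        (trans (run-++ E* F* (subst (λ k → run (replicate k (E t)) _ ≡ _) fb (lower-true-branch w a b)))
               (raise-prefix w X _ X-low-g
                  (++⁺ (g-highfree {a}) (low⇒¬high g Y Y-low-g ∷ g-highfree′))))
        (trans (run-++ E* F* (lower-false-branch w r₂)) (raise-prefix w Y _ Y-low-g g-highfree′))
        (λ e → true≢false (trans (sym u′-inverted) (trans e v′-not-inverted)))
      where
        E* F* : List (Op n)
        E* = replicate (falses r₂) (E t)
        F* = replicate (length w + 1) (F g)
        u′ v′ : Word n
        u′ = embed X⁺ Y⁺ w ++ X⁺ ∷ embed X Y a ++ Y ∷ embed X Y′ b
        v′ = embed X⁺ Y⁺ w ++ Y⁺ ∷ embed X Y′ r₂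
        g-highfree′ : ∀ {s} → HighFree g (embed X Y′ s)
        g-highfree′ = All-embed (low⇒¬high g X X-low-g) eY-¬high-g
        u′-inverted : hasInv t u′ ≡ true
        u′-inverted = hasInv-witness t (embed X⁺ Y⁺ w) X⁺ (embed X Y a) Y (embed X Y′ b) fX-low-t Y-high-t
        v′-not-inverted : hasInv t v′ ≡ false
        v′-not-inverted = hasInv-free t [] v′ []
          (++⁺ (All-embed (low⇒¬high t X⁺ fX-low-t) fY-¬high-t) (fY-¬high-t ∷ All-embed X-¬high-t eY-¬high-t))
        true≢false : true ≢ false
        true≢false ()

  gadget⇒separating : ∀ {X Y} → Gadget X Y → Separating X Y
  gadget⇒separating G s₁ s₂ s≢ t≡ f≡ with first-difference s₁ s₂ s≢ t≡ f≡
  ... | inj₁ d = separated-at G d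
  ... | inj₂ d = separated-sym (separated-at G d)

  gadget-un-br : ∀ (jx jy : Fin n) → toℕ jy ≡ suc (toℕ jx) → suc (toℕ jy) < n → Gadget (un jx) (br jy)
  gadget-un-br jx jy e q = record
    { g = jx ; t = jy
    ; X-low-g    = ≡ᵇ-true {toℕ jx} refl
    ; Y-low-g    = ≡ᵇ-true {toℕ jy} e
    ; X-¬low-t   = ≡ᵇ-false {toℕ jx} λ e′ → n≢1+n (trans e′ e)
    ; X-¬high-t  = ≡ᵇ-false {toℕ jx} λ e′ → n≢2+n (trans e′ (cong suc e))
    ; Y-high-t   = ≡ᵇ-true {toℕ jy} refl
    ; eY-¬high-g = eY-¬high-g
    ; eY-¬high-t = eY-¬high-t
    ; fX-low-t   = fX-low-t
    ; fY-¬high-t = ≡ᵇ-false {toℕ jx} λ e′ → n≢1+n (trans e′ e)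
    }
    where
      q′ : suc (toℕ jx) < n
      q′ = subst (_< n) e (toℕ<n jy)
      eY-¬high-g : high jx (eImg jy (br jy)) ≡ false
      eY-¬high-g rewrite eImg-br-< jy jy q =
        ≡ᵇ-false {toℕ (fromℕ< q)} λ e′ → n≢2+n (trans (sym e′) (trans (toℕ-fromℕ< q) (cong suc e)))
      eY-¬high-t : high jy (eImg jy (br jy)) ≡ false
      eY-¬high-t rewrite eImg-br-< jy jy q =
        ≡ᵇ-false {toℕ (fromℕ< q)} λ e′ → n≢1+n (trans (sym e′) (toℕ-fromℕ< q))
      fX-low-t : low jy (fImg jx (un jx)) ≡ true
      fX-low-t rewrite fImg-un-< jx jx q′ = ≡ᵇ-true {toℕ (fromℕ< q′)} (trans (toℕ-fromℕ< q′) (sym e))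

  gadget-br-un : ∀ (jx jy k : Fin n) → toℕ jy ≡ suc (toℕ jx) → toℕ jx ≡ suc (toℕ k) → Gadget (br jy) (un jx)
  gadget-br-un jx jy k e ek = record
    { g = jx ; t = k
    ; X-low-g    = ≡ᵇ-true {toℕ jy} e
    ; Y-low-g    = ≡ᵇ-true {toℕ jx} refl
    ; X-¬low-t   = ≡ᵇ-false {toℕ jy} λ e′ → n≢1+n (trans (sym e′) jy≡2+k)
    ; X-¬high-t  = ≡ᵇ-false {toℕ jy} λ e′ → n≢2+n (trans (sym e′) jy≡2+k)
    ; Y-high-t   = ≡ᵇ-true {toℕ jx} ek
    ; eY-¬high-g = ≡ᵇ-false {toℕ k} λ e′ → n≢2+n (trans e′ (cong suc ek))
    ; eY-¬high-t = ≡ᵇ-false {toℕ k} n≢1+n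
    ; fX-low-t   = ≡ᵇ-true {toℕ jx} ek
    ; fY-¬high-t = fY-¬high-t
    }
    where
      jy≡2+k : toℕ jy ≡ suc (suc (toℕ k))
      jy≡2+k = trans e (cong suc ek)
      fY-¬high-t : high k (fImg jx (un jx)) ≡ false
      fY-¬high-t with suc (toℕ jx) <? n
      ... | yes p = ≡ᵇ-false {toℕ (fromℕ< p)} λ e′ → n≢1+n (trans (sym e′) (trans (toℕ-fromℕ< p) (cong suc ek)))
      ... | no _  = ≡ᵇ-false {toℕ jx} λ e′ → n≢1+n (trans (sym e′) ek)

  predecessor : ∀ (j : Fin n) → 0 < toℕ j → Σ (Fin n) λ k → toℕ j ≡ suc (toℕ k)
  predecessor j 0<j = k , trans (sym (suc-pred (toℕ j) {{>-nonZero 0<j}})) (cong suc (sym (toℕ-fromℕ< k<n)))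
    where
      k<n : pred (toℕ j) < n
      k<n = ≤-<-trans pred[n]≤n (toℕ<n j)
      k : Fin n
      k = fromℕ< k<n

  -- The only use of n ≥ 3: the first gadget needs ë_jy to move br jy, i.e. jy + 1 < n;
  -- otherwise jx = n − 2 ≥ 1 and the swapped gadget with t = jx − 1 applies.
  separating-adjacent : 3 ≤ n → ∀ (jx jy : Fin n) → toℕ jy ≡ suc (toℕ jx) → Separating (un jx) (br jy)
  separating-adjacent 3≤n jx jy e with suc (toℕ jy) <? n
  ... | yes q = gadget⇒separating (gadget-un-br jx jy e q)
  ... | no ¬q =
    let k , ek = predecessor jx 0<jx
    in separating-swap (gadget⇒separating (gadget-br-un jx jy k e ek))
    where
      0<jx : 0 < toℕ jx
      0<jx = ≤-pred (≤-pred (≤-trans 3≤n (subst (n ≤_) (cong suc e) (≮⇒≥ ¬q))))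

  step-above : ∀ (jx i : Fin n) {y y′} → toℕ jx < toℕ i → low i y ≡ true → fImg i y ≡ y′ → Step (un jx) y y′
  step-above jx i lt ly fy =
    step i ly (≡ᵇ-false {toℕ jx} (<⇒≢ lt)) (≡ᵇ-false {toℕ jx} (<⇒≢ (m<n⇒m<1+n lt))) fy

  descend : ∀ (jx : Fin n) d (j : Fin n) → toℕ j ≡ suc (toℕ jx + d) →
            Σ (Fin n) λ j′ → toℕ j′ ≡ suc (toℕ jx) × Star (Step (un jx)) (br j) (br j′)
  descend jx zero j e = j , trans e (cong suc (+-identityʳ _)) , ε
  descend jx (suc d) j e =
    let j′ , e′ , path = descend jx d i (toℕ-fromℕ< i<n)
    in j′ , e′ , step-above jx i jx<i low-i refl ◅ path
    where
      j≡2+ : toℕ j ≡ suc (suc (toℕ jx + d))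
      j≡2+ = trans e (cong suc (+-suc (toℕ jx) d))
      i<n : suc (toℕ jx + d) < n
      i<n = ≤-trans (n≤1+n _) (subst (_< n) j≡2+ (toℕ<n j))
      i : Fin n
      i = fromℕ< i<n
      jx<i : toℕ jx < toℕ i
      jx<i = subst (toℕ jx <_) (sym (toℕ-fromℕ< i<n)) (s≤s (m≤m+n _ d))
      low-i : low i (br j) ≡ true
      low-i = ≡ᵇ-true {toℕ j} (trans j≡2+ (cong suc (sym (toℕ-fromℕ< i<n))))

  ascend : ∀ (jx : Fin n) d (j : Fin n) → suc (toℕ j + d) ≡ n → toℕ jx < toℕ j →
           Σ (Fin n) λ j′ → toℕ jx < toℕ j′ × Star (Step (un jx)) (un j) (br j′)
  ascend jx zero j e lt = j , lt , step-above jx j lt (≡ᵇ-true {toℕ j} refl) (fImg-un-last j j last) ◅ ε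
    where
      last : ¬ suc (toℕ j) < n
      last j<n = <⇒≢ j<n (trans (cong suc (sym (+-identityʳ _))) e)
  ascend jx (suc d) j e lt =
    let j′ , lt′ , path = ascend jx d i (trans (cong (λ m → suc (m + d)) (toℕ-fromℕ< j+1<n)) e′) jx<i
    in j′ , lt′ , step-above jx j lt (≡ᵇ-true {toℕ j} refl) (fImg-un-< j j j+1<n) ◅ path
    where
      e′ : suc (suc (toℕ j + d)) ≡ n
      e′ = trans (cong suc (sym (+-suc (toℕ j) d))) e
      j+1<n : suc (toℕ j) < n
      j+1<n = subst (suc (toℕ j) <_) e′ (s≤s (s≤s (m≤m+n _ d)))
      i : Fin n
      i = fromℕ< j+1<n
      jx<i : toℕ jx < toℕ i
      jx<i = subst (toℕ jx <_) (sym (toℕ-fromℕ< j+1<n)) (m<n⇒m<1+n lt)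

  index : Letter n → Fin n
  index (un j) = j
  index (br j) = j

  index-bar : ∀ x → index (bar x) ≡ index x
  index-bar (un j) = refl
  index-bar (br j) = refl

  -- In the paper's letters: j ↦ j+1 ↦ … ↦ n ↦ n̄ ↦ … ↦ bar (p+1), each by an f̈_i fixing p.
  reach-adjacent : ∀ (jx : Fin n) y → toℕ jx < toℕ (index y) →
                   Σ (Fin n) λ j′ → toℕ j′ ≡ suc (toℕ jx) × Star (Step (un jx)) y (br j′)
  reach-adjacent jx (br j) lt = descend jx (toℕ j ∸ suc (toℕ jx)) j (sym (m+[n∸m]≡n lt))
  reach-adjacent jx (un j) lt =
    let j₁ , lt₁ , up = ascend jx (n ∸ suc (toℕ j)) j (m+[n∸m]≡n (toℕ<n j)) lt
        j′ , e′ , down = descend jx (toℕ j₁ ∸ suc (toℕ jx)) j₁ (sym (m+[n∸m]≡n lt₁))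
    in j′ , e′ , up ◅◅ down

  separating-above : 3 ≤ n → ∀ (jx : Fin n) y → toℕ jx < toℕ (index y) → Separating (un jx) y
  separating-above 3≤n jx y lt =
    let j′ , e′ , path = reach-adjacent jx y lt
    in separating-along path (separating-adjacent 3≤n jx j′ e′)

  separating-< : 3 ≤ n → ∀ x y → toℕ (index x) < toℕ (index y) → Separating x y
  separating-< 3≤n (un j) y lt = separating-above 3≤n j y lt
  separating-< 3≤n (br j) y lt =
    separating-dual
      (separating-above 3≤n j (bar y) (subst (λ i → toℕ j < toℕ i) (sym (index-bar y)) lt))

  separating-≢ : 3 ≤ n → ∀ x y → index x ≢ index y → Separating x y
  separating-≢ 3≤n x y x≢y with Fin.<-cmp (index x) (index y)
  ... | tri< lt _ _ = separating-< 3≤n x y lt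
  ... | tri≈ _ eq _ = ⊥-elim (x≢y eq)
  ... | tri> _ _ gt = separating-swap (separating-< 3≤n y x gt)

  isUn-isBr-other : ∀ (j : Fin n) y → index y ≢ j → isUn j y ≡ false × isBr j y ≡ false
  isUn-isBr-other j (un k) ne = ≡ᵇ-false {toℕ k} (ne ∘ toℕ-injective) , refl
  isUn-isBr-other j (br k) ne = refl , ≡ᵇ-false {toℕ k} (ne ∘ toℕ-injective)

  lookup-wt-embed : ∀ (j : Fin n) x y s →
    lookup (wt (embed x y s)) j ≡ tally (isUn j x) (isUn j y) s ⊖ tally (isBr j x) (isBr j y) s
  lookup-wt-embed j x y s =
    trans (lookup∘tabulate _ j) (cong₂ _⊖_ (countᵇ-embed (isUn j) x y s) (countᵇ-embed (isBr j) x y s))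

  ∣wt∣ : Word n → Fin n → ℕ
  ∣wt∣ w j = ∣ lookup (wt w) j ∣

  ∣wt∣-embed : ∀ x y s → index y ≢ index x → ∣wt∣ (embed x y s) (index x) ≡ trues s
  ∣wt∣-embed (un j) y s ne with isUn-isBr-other j y ne
  ... | u , b rewrite lookup-wt-embed j (un j) y s | u | b | ≡ᵇ-true {toℕ j} refl | tally-false-false s = refl
  ∣wt∣-embed (br j) y s ne with isUn-isBr-other j y ne
  ... | u , b rewrite lookup-wt-embed j (br j) y s | u | b | ≡ᵇ-true {toℕ j} refl | tally-false-false s =
    ∣m⊖n∣≡∣n⊖m∣ 0 (trues s)

  ∣wt∣-embed-second : ∀ x y s → index x ≢ index y → ∣wt∣ (embed x y s) (index y) ≡ falses s
  ∣wt∣-embed-second x y s ne = begin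
    ∣wt∣ (embed x y s) (index y)          ≡⟨ cong (λ w → ∣wt∣ w (index y)) (embed-swap x y s) ⟩
    ∣wt∣ (embed y x (map not s)) (index y) ≡⟨ ∣wt∣-embed y x (map not s) ne ⟩
    trues (map not s)                     ≡⟨ tally-map-not true false s ⟩
    falses s                              ∎

  ∣wt∣-embed-diag : ∀ x s → ∣wt∣ (embed x x s) (index x) ≡ length s
  ∣wt∣-embed-diag (un j) s
    rewrite lookup-wt-embed j (un j) (un j) s | ≡ᵇ-true {toℕ j} refl | tally-false-false s | tally-true-true s = refl
  ∣wt∣-embed-diag (br j) s
    rewrite lookup-wt-embed j (br j) (br j) s | ≡ᵇ-true {toℕ j} refl | tally-false-false s | tally-true-true s =
    ∣m⊖n∣≡∣n⊖m∣ 0 (length s)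

  ∣wt∣-invariant : ∀ {u v : Word n} {j m m′} → u ∼h v → ∣wt∣ u j ≡ m → ∣wt∣ v j ≡ m′ → m ≡ m′
  ∣wt∣-invariant {j = j} (ψ , iso) hu hv =
    trans (sym hu) (trans (cong (λ w → ∣ lookup w j ∣) (trans (sym (wt-eq here)) (cong wt base))) hv)
    where open IsoComp iso

  embed-diag : ∀ (x : Letter n) s → embed x x s ≡ replicate (length s) x
  embed-diag x [] = refl
  embed-diag x (true ∷ s) = cong (x ∷_) (embed-diag x s)
  embed-diag x (false ∷ s) = cong (x ∷_) (embed-diag x s)

  same-index⇒≡ : ∀ x y → index x ≡ index y → x ≢ bar y → x ≡ y
  same-index⇒≡ (un j) (un k) e _ = cong un e
  same-index⇒≡ (br j) (br k) e _ = cong br e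
  same-index⇒≡ (un j) (br k) e x≢ȳ = ⊥-elim (x≢ȳ (cong un e))
  same-index⇒≡ (br j) (un k) e x≢ȳ = ⊥-elim (x≢ȳ (cong br e))

  ∼h-refl : ∀ (u : Word n) → u ∼h u
  ∼h-refl u = id , record
    { base = refl ; into = id ; inj = λ _ _ → id ; surj = λ {y} r → y , r , refl
    ; wt-eq = λ _ → refl ; ε-eq = λ _ _ → refl ; φ-eq = λ _ _ → refl
    ; e-comm = λ {x} _ i → sym (Maybe.map-id (eq i x))
    ; f-comm = λ {x} _ i → sym (Maybe.map-id (fq i x))
    }

  binary-∼h⇒≡ : 3 ≤ n → ∀ {a b} → a ≢ bar b →
                ∀ s₁ s₂ → embed a b s₁ ∼h embed a b s₂ → embed a b s₁ ≡ embed a b s₂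
  binary-∼h⇒≡ 3≤n {a} {b} a≢b̄ s₁ s₂ u∼v with index a Fin.≟ index b
  ... | yes same with same-index⇒≡ a b same a≢b̄
  ...   | refl = begin
    embed a a s₁             ≡⟨ embed-diag a s₁ ⟩
    replicate (length s₁) a  ≡⟨ cong (λ m → replicate m a) length≡ ⟩
    replicate (length s₂) a  ≡⟨ embed-diag a s₂ ⟨
    embed a a s₂             ∎
    where
      length≡ : length s₁ ≡ length s₂
      length≡ = ∣wt∣-invariant u∼v (∣wt∣-embed-diag a s₁) (∣wt∣-embed-diag a s₂)
  binary-∼h⇒≡ 3≤n {a} {b} a≢b̄ s₁ s₂ u∼v | no differ with ≡-dec Bool._≟_ s₁ s₂
  ... | yes refl = refl
  ... | no s≢ = ⊥-elim (separated⇒≁ (separating-≢ 3≤n a b differ s₁ s₂ s≢ trues≡ falses≡) u∼v)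
    where
      trues≡ : trues s₁ ≡ trues s₂
      trues≡ = ∣wt∣-invariant u∼v (∣wt∣-embed a b s₁ (differ ∘ sym)) (∣wt∣-embed a b s₂ (differ ∘ sym))
      falses≡ : falses s₁ ≡ falses s₂
      falses≡ = ∣wt∣-invariant u∼v (∣wt∣-embed-second a b s₁ differ) (∣wt∣-embed-second a b s₂ differ)

theorem9p34 : (n : ℕ) → 3 ≤ n → (a b : Letter n) → a ≢ bar b →
    (u v : Word n) → All (λ c → c ≡ a ⊎ c ≡ b) u → All (λ c → c ≡ a ⊎ c ≡ b) v →
    ((u ∼h v) ⇔ (u ≡ v))
theorem9p34 n 3≤n a b a≢b̄ u v u∈ v∈ = mk⇔ to from
  where
    to : u ∼h v → u ≡ v
    to u∼v with embed-of a b u u∈ | embed-of a b v v∈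
    ... | s₁ , refl | s₂ , refl = binary-∼h⇒≡ 3≤n a≢b̄ s₁ s₂ u∼v
    from : u ≡ v → u ∼h v
    from refl = ∼h-refl u
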